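{- Let $G$ be a $P_4$-sparse graph consisting of exactly two connected components with vertex sets $C_u\ni u$ and $C_v\ni v$. Suppose that an optimal solution $H$ of the ($P_4$-sparse-2CC,$+1$)-MinEdgeAddition Problem for $G$ and the non-edge $uv$ is a thin spider with spider partition $(S,K,R)$ and $u,v\in R$. If $S\cup K$ contains vertices from both $C_u$ and $C_v$, then there exists an optimal solution $H'$ of the same problem (a) which results from making $u$ or $v$ universal in $G$, or (b) in which the subtree $T_{u,1}(H')$ is identical to $T_{u,1}(G[C_u])$ or to $T_{v,1}(G[C_v])$, where alternative (b) arises in the case in which $K\cap C_u=\{u'\}$ and $K\cap C_v=\{v'\}$, in $G$ the vertex $u$ is adjacent only to $u'$ and $u'$ is adjacent to all other vertices of $C_u$, and $v$ is adjacent only to $v'$ and $v'$ is adjacent to all other vertices of $C_v$.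
   Context: All graphs are finite, simple, undirected. A graph is $P_4$-sparse if no five vertices induce more than one $P_4$. A spider is a graph with vertex partition $(S,K,R)$ (spider partition), $S$ independent, $K$ a clique, $|S|=|K|\ge2$, $R$ complete to $K$ and anticomplete to $S$, and a bijection $f:S\to K$ with either $N(s)\cap K=\{f(s)\}$ for all $s$ (thin) or $N(s)\cap K=K\setminus\{f(s)\}$ for all $s$ (thick). Every $P_4$-sparse graph $G$ has a unique $P_4$-sparse tree $T_G$: a rooted tree whose leaves correspond bijectively to the vertices, internal nodes have at least two children and labels $0,1,2$ differing from the parent's; two vertices are non-adjacent (adjacent) if the least common ancestor of their leaves is a $0$-node ($1$-node), and leaves below a $2$-node induce a spider. For a vertex $u$ with root-to-leaf path $t_1t_2\cdots t_r$ in $T_G$, $T_{u,1}(G)$ is the component containing $t_1$ after deleting the tree edge $t_1t_2$. "Making $u$ universal in $G$" means adding all edges from $u$ to its non-neighbours. ($P_4$-sparse-2CC,$+1$)-MinEdgeAddition Problem: $G$ is $P_4$-sparse with exactly two connected components $C_u\ni u$, $C_v\ni v$; a solution is a $P_4$-sparse $H$ with $V(H)=V(G)$, $E(G)\cup\{uv\}\subseteq E(H)$; fill edges are $E(H)\setminus E(G)$ (including $uv$); optimal solutions minimize their number. -}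

module Defs where

open import Data.Nat using (ℕ; zero; suc; _≤_; _<ᵇ_; _+_)
open import Data.Fin using (Fin; toℕ; _≟_) renaming (zero to f0; suc to fs)
open import Data.Bool using (Bool; true; false; _∧_; _∨_; not; if_then_else_)
open import Data.List using (List; []; _∷_; _++_; map; filter; length; allFin)
open import Data.Nat.ListAction using (sum)
open import Data.List.Membership.Propositional using (_∈_; _∉_)
import Data.List.Membership.DecPropositional as DecMem
open import Data.List.Relation.Unary.All using (All)
open import Data.List.Relation.Unary.AllPairs using (AllPairs)
open import Data.List.Relation.Unary.Unique.Propositional using (Unique)
open import Data.List.Relation.Binary.Permutation.Propositional using (_↭_)
open import Data.Maybe using (Maybe; just; nothing)
open import Data.Product using (Σ; ∃; _×_; _,_)
open import Data.Sum using (_⊎_)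
open import Data.Unit using (⊤)
open import Data.Vec.Functional using (toList)
open import Relation.Binary.PropositionalEquality using (_≡_; _≢_)
open import Relation.Nullary using (¬_; ¬?)
open import Relation.Nullary.Decidable using (⌊_⌋)

infix 3 _⟺_
_⟺_ : Set → Set → Set
A ⟺ B = (A → B) × (B → A)

record Graph (n : ℕ) : Set where
  field
    adj    : Fin n → Fin n → Bool
    sym    : ∀ x y → adj x y ≡ adj y x
    irrefl : ∀ x → adj x x ≡ false
open Graph public

Adj : ∀ {n} → Graph n → Fin n → Fin n → Set
Adj G x y = adj G x y ≡ true

NonAdj : ∀ {n} → Graph n → Fin n → Fin n → Set
NonAdj G x y = adj G x y ≡ false

InducedP4 : ∀ {n} → Graph n → Fin n → Fin n → Fin n → Fin n → Set
InducedP4 G a b c d =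
  Adj G a b × Adj G b c × Adj G c d ×
  NonAdj G a c × NonAdj G b d × NonAdj G a d

-- P4-sparse: no five vertices induce more than one P4, i.e. among any five
-- distinct vertices, any two induced P4s have the same vertex set.
P4Sparse : ∀ {n} → Graph n → Set
P4Sparse {n} G =
  (w : Fin 5 → Fin n) → (∀ i j → w i ≡ w j → i ≡ j) →
  (p q : Fin 4 → Fin 5) →
  InducedP4 G (w (p f0)) (w (p (fs f0))) (w (p (fs (fs f0)))) (w (p (fs (fs (fs f0))))) →
  InducedP4 G (w (q f0)) (w (q (fs f0))) (w (q (fs (fs f0)))) (w (q (fs (fs (fs f0))))) →
  ∀ k → (∃ λ a → p a ≡ k) ⟺ (∃ λ a → q a ≡ k)

data Reach {n} (G : Graph n) (x : Fin n) : Fin n → Set where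
  here : Reach G x x
  step : ∀ {y z} → Reach G x y → Adj G y z → Reach G x z

TwoComponents : ∀ {n} → Graph n → Fin n → Fin n → Set
TwoComponents G u v = ¬ Reach G u v × (∀ x → Reach G u x ⊎ Reach G v x)

-- number of fill edges E(H) \ E(G) (unordered pairs)
fillCount : ∀ {n} → Graph n → Graph n → ℕ
fillCount {n} G H =
  sum (map (λ x → sum (map (λ y →
        if (toℕ x <ᵇ toℕ y) ∧ adj H x y ∧ not (adj G x y) then 1 else 0)
      (allFin n))) (allFin n))

IsSolution : ∀ {n} → Graph n → Fin n → Fin n → Graph n → Set
IsSolution G u v H = P4Sparse H × (∀ x y → Adj G x y → Adj H x y) × Adj H u v

IsOptimal : ∀ {n} → Graph n → Fin n → Fin n → Graph n → Set
IsOptimal {n} G u v H =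
  IsSolution G u v H × ((H' : Graph n) → IsSolution G u v H' → fillCount G H ≤ fillCount G H')

MakeUniversal : ∀ {n} → Graph n → Fin n → Graph n → Set
MakeUniversal G u H =
  ∀ x y → adj H x y ≡ (adj G x y ∨ ((⌊ x ≟ u ⌋ ∨ ⌊ y ≟ u ⌋) ∧ not ⌊ x ≟ y ⌋))

-- Spiders.  S K : Fin m → Fin n with f(S i) = K i; R a set of vertices.

record SpiderCore {n} (G : Graph n) (m : ℕ) (S K : Fin m → Fin n) (R : Fin n → Set) : Set where
  field
    two≤m     : 2 ≤ m
    S-inj     : ∀ i j → S i ≡ S j → i ≡ j
    K-inj     : ∀ i j → K i ≡ K j → i ≡ j
    S≢K       : ∀ i j → S i ≢ K j
    S∉R       : ∀ i → ¬ R (S i)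
    K∉R       : ∀ i → ¬ R (K i)
    S-indep   : ∀ i j → NonAdj G (S i) (S j)
    K-clique  : ∀ i j → i ≢ j → Adj G (K i) (K j)
    R-K       : ∀ r i → R r → Adj G r (K i)
    R-S       : ∀ r i → R r → NonAdj G r (S i)

Thin : ∀ {n m} → Graph n → (S K : Fin m → Fin n) → Set
Thin G S K = ∀ i j → Adj G (S i) (K j) ⟺ i ≡ j

Thick : ∀ {n m} → Graph n → (S K : Fin m → Fin n) → Set
Thick G S K = ∀ i j → Adj G (S i) (K j) ⟺ i ≢ j

InSK : ∀ {n m} → (S K : Fin m → Fin n) → Fin n → Set
InSK S K x = (∃ λ i → S i ≡ x) ⊎ (∃ λ i → K i ≡ x)

InK : ∀ {n m} → (K : Fin m → Fin n) → Fin n → Set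
InK K x = ∃ λ i → K i ≡ x

SpiderPartition : ∀ {n} (G : Graph n) (m : ℕ) (S K : Fin m → Fin n) (R : Fin n → Set) → Set
SpiderPartition G m S K R =
  SpiderCore G m S K R × (∀ x → InSK S K x ⊎ R x) × (Thin G S K ⊎ Thick G S K)

data Label : Set where
  lab0 lab1 lab2 : Label

data Tree (n : ℕ) : Set where
  leaf : Fin n → Tree n
  node : Label → List (Tree n) → Tree n

mutual
  leaves : ∀ {n} → Tree n → List (Fin n)
  leaves (leaf x) = x ∷ []
  leaves (node l cs) = leaves* cs

  leaves* : ∀ {n} → List (Tree n) → List (Fin n)
  leaves* [] = []
  leaves* (c ∷ cs) = leaves c ++ leaves* cs

rootLabel : ∀ {n} → Tree n → Maybe Label
rootLabel (leaf x) = nothing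
rootLabel (node l cs) = just l

-- children of a node may not carry the same label as the node (0/1 nodes);
-- for a 2-node see NodeOK below (its children are the leaves of S ∪ K and
-- possibly one subtree for R).
ParentOK : ∀ {n} → Label → Tree n → Set
ParentOK lab0 c = rootLabel c ≢ just lab0
ParentOK lab1 c = rootLabel c ≢ just lab1
ParentOK lab2 c = ⊤

NodeOK : ∀ {n} → Graph n → Label → List (Tree n) → Set
NodeOK G lab0 cs = AllPairs (λ c d → ∀ x y → x ∈ leaves c → y ∈ leaves d → NonAdj G x y) cs
NodeOK G lab1 cs = AllPairs (λ c d → ∀ x y → x ∈ leaves c → y ∈ leaves d → Adj G x y) cs
NodeOK {n} G lab2 cs =
  Σ ℕ λ m → Σ (Fin m → Fin n) λ S → Σ (Fin m → Fin n) λ K → Σ (List (Tree n)) λ rest →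
    length rest ≤ 1 ×
    cs ↭ (map leaf (toList S ++ toList K) ++ rest) ×
    SpiderCore G m S K (λ x → x ∈ leaves* rest) ×
    (Thin G S K ⊎ Thick G S K)

data WF {n} (G : Graph n) : Tree n → Set where
  wf-leaf : ∀ x → WF G (leaf x)
  wf-node : ∀ {l cs} → All (WF G) cs → 2 ≤ length cs →
            All (ParentOK l) cs → NodeOK G l cs → WF G (node l cs)

IsP4sTree : ∀ {n} → Graph n → (Fin n → Set) → Tree n → Set
IsP4sTree G X T = WF G T × Unique (leaves T) × (∀ x → x ∈ leaves T ⟺ X x)

-- T_{u,1}: delete the root's child-branch containing u
cutAt : ∀ {n} → Fin n → Tree n → Tree n
cutAt u (leaf x) = leaf x
cutAt {n} u (node l cs) = node l (filter (λ c → ¬? (DecMem._∈?_ (_≟_ {n}) u (leaves c))) cs)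

-- identity of (rooted, labelled, leaf-labelled) trees, children unordered
mutual
  data _≈T_ {n} : Tree n → Tree n → Set where
    leaf≈ : ∀ x → leaf x ≈T leaf x
    node≈ : ∀ {l cs ds} → cs ≈L ds → node l cs ≈T node l ds

  data _≈L_ {n} : List (Tree n) → List (Tree n) → Set where
    []≈ : [] ≈L []
    ∷≈  : ∀ {t t' ts xs ys} → t ≈T t' → ts ≈L (xs ++ ys) → (t ∷ ts) ≈L (xs ++ t' ∷ ys)

SubtreeIdentical : ∀ {n} → Graph n → Graph n → Fin n → Fin n → Set
SubtreeIdentical {n} H' G a b =
  Σ (Tree n) λ T₁ → Σ (Tree n) λ T₂ →
    IsP4sTree H' (λ _ → ⊤) T₁ × IsP4sTree G (Reach G b) T₂ × (cutAt a T₁ ≈T cutAt b T₂)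

CaseB : ∀ {n m} → Graph n → (K : Fin m → Fin n) → Fin n → Fin n → Set
CaseB {n} G K u v =
  Σ (Fin n) λ u' → Σ (Fin n) λ v' →
    (∀ x → (InK K x × Reach G u x) ⟺ x ≡ u') ×
    (∀ x → (InK K x × Reach G v x) ⟺ x ≡ v') ×
    (∀ x → Adj G u x ⟺ x ≡ u') × (∀ x → Reach G u x → x ≢ u' → Adj G u' x) ×
    (∀ x → Adj G v x ⟺ x ≡ v') × (∀ x → Reach G v x → x ≢ v' → Adj G v' x)

-- Making v universal in G always gives an optimal solution, i.e. alternative (a) holds.
-- It is a solution because a universal vertex lies on no induced P4 (every vertex of a
-- P4 has a non-neighbour on it), so the induced P4s are those of G. Its fill edges are
-- the pairs vw with w ≠ v a non-neighbour of v in G, so it suffices to map these w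
-- injectively to fill edges of H. In the thin spider H, R is complete to K, K is a clique,
-- and S i has K i as its only neighbour, so S i and K i lie in the same component of G;
-- by hypothesis both components C_u, C_v contain some K-vertex k_u, k_v. Send
--   w ∈ R ∩ C_u to w k_v (u to uv),   K i ∈ C_u to K i v,   S i ∈ C_u to K i k_v,
--   w ∈ R ∩ C_v to w k_u,             K j ∈ C_v to v K j,   S j ∈ C_v to u K j.
-- Each image is an edge of H missing from G (it joins the two components, or it is v K j
-- with K j a non-neighbour of v), and the roles and components of its ends determine w.

{-# OPTIONS --safe #-}
module Submission where

open import Defs hiding (sym)
open import Data.Bool using (Bool; true; false; T; _∧_; _∨_; not; if_then_else_)
open import Data.Bool.Properties using (T-≡; T-not-≡; T-∧; ∨-comm; ∨-zeroʳ; ∨-identityʳ; ∧-zeroʳ)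
open import Data.Empty using (⊥-elim)
open import Data.Fin using (Fin; toℕ; _≟_)
open import Data.Fin.Properties using (toℕ-injective)
open import Data.List using (List; []; _∷_; _++_; map; filter; length; allFin; cartesianProduct)
open import Data.List.Properties using (length-++; length-++-sucʳ; length-map; filter-++; map-∘; map-id-local)
open import Data.List.Membership.Propositional using (_∈_)
open import Data.List.Membership.Propositional.Properties
  using (∈-∃++; ∈-++⁻; ∈-++⁺ˡ; ∈-++⁺ʳ; ∈-filter⁺; ∈-filter⁻; ∈-cartesianProduct⁺; ∈-allFin; ∈-map⁻)
open import Data.List.Relation.Binary.Subset.Propositional using (_⊆_)
open import Data.List.Relation.Unary.All using (tabulate; lookup)
open import Data.List.Relation.Unary.Any using (here; there)
open import Data.List.Relation.Unary.Unique.Propositional using (Unique; _∷_)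
import Data.List.Relation.Unary.Unique.Propositional.Properties as Uniqueₚ
open import Data.Nat using (ℕ; suc; _≤_; _+_; _<ᵇ_; s≤s; z≤n)
open import Data.Nat.ListAction using (sum)
open import Data.Nat.Properties using (<ᵇ⇒<; <⇒<ᵇ; <-asym; <-cmp; ≤-trans; ≤-reflexive; module ≤-Reasoning)
open import Data.Product using (Σ; ∃; _×_; _,_; proj₁; proj₂; uncurry)
open import Data.Sum using (_⊎_; inj₁; inj₂)
open import Function using (_∘_)
open import Function.Bundles using (Equivalence)
open import Relation.Binary.Definitions using (tri<; tri≈; tri>)
open import Relation.Binary.PropositionalEquality
open import Relation.Nullary using (¬_; contradiction; yes; no)
open import Relation.Nullary.Decidable using (Dec; T?; ⌊_⌋; isYes≗does; dec-true; dec-false)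

Unique-⊆⇒length-≤ : ∀ {A : Set} {xs ys : List A} → Unique xs → xs ⊆ ys → length xs ≤ length ys
Unique-⊆⇒length-≤ {xs = []} _ _ = z≤n
Unique-⊆⇒length-≤ {xs = x ∷ xs} (x∉xs ∷ uxs) xs⊆ys with ys₁ , ys₂ , refl ← ∈-∃++ (xs⊆ys (here refl)) =
  ≤-trans (s≤s (Unique-⊆⇒length-≤ uxs xs⊆ys₁++ys₂)) (≤-reflexive (sym (length-++-sucʳ ys₁ x ys₂)))
  where
  xs⊆ys₁++ys₂ : xs ⊆ ys₁ ++ ys₂
  xs⊆ys₁++ys₂ {z} z∈xs with ∈-++⁻ ys₁ (xs⊆ys (there z∈xs))
  ... | inj₁ z∈ys₁ = ∈-++⁺ˡ z∈ys₁
  ... | inj₂ (here refl) = contradiction refl (lookup x∉xs z∈xs)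
  ... | inj₂ (there z∈ys₂) = ∈-++⁺ʳ ys₁ z∈ys₂

module _ {n : ℕ} where

  count : (Fin n → Fin n → Bool) → ℕ
  count P = sum (map (λ x → sum (map (λ y → if P x y then 1 else 0) (allFin n))) (allFin n))

  pairsWhere : (Fin n → Fin n → Bool) → List (Fin n × Fin n)
  pairsWhere P = filter (T? ∘ uncurry P) (cartesianProduct (allFin n) (allFin n))

  count≡length-pairsWhere : ∀ P → count P ≡ length (pairsWhere P)
  count≡length-pairsWhere P = sym (rows (allFin n))
    where
    P? = T? ∘ uncurry P
    row : ∀ x ys → length (filter P? (map (x ,_) ys)) ≡ sum (map (λ y → if P x y then 1 else 0) ys)
    row x [] = refl
    row x (y ∷ ys) with P x y
    ... | true = cong suc (row x ys)
    ... | false = row x ys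
    rows : ∀ xs → length (filter P? (cartesianProduct xs (allFin n)))
                ≡ sum (map (λ x → sum (map (λ y → if P x y then 1 else 0) (allFin n))) xs)
    rows [] = refl
    rows (x ∷ xs) = begin
      length (filter P? (map (x ,_) (allFin n) ++ cartesianProduct xs (allFin n)))
        ≡⟨ cong length (filter-++ P? (map (x ,_) (allFin n)) _) ⟩
      length (filter P? (map (x ,_) (allFin n)) ++ filter P? (cartesianProduct xs (allFin n)))
        ≡⟨ length-++ (filter P? (map (x ,_) (allFin n))) ⟩
      length (filter P? (map (x ,_) (allFin n))) + length (filter P? (cartesianProduct xs (allFin n)))
        ≡⟨ cong₂ _+_ (row x (allFin n)) (rows xs) ⟩
      sum (map (λ y → if P x y then 1 else 0) (allFin n)) + sum (map (λ x → sum (map (λ y → if P x y then 1 else 0) (allFin n))) xs)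
        ∎
      where open ≡-Reasoning

  ∈-pairsWhere⁺ : ∀ {P p} → T (uncurry P p) → p ∈ pairsWhere P
  ∈-pairsWhere⁺ {p = x , y} = ∈-filter⁺ (T? ∘ uncurry _) (∈-cartesianProduct⁺ (∈-allFin x) (∈-allFin y))

  ∈-pairsWhere⁻ : ∀ {P p} → p ∈ pairsWhere P → T (uncurry P p)
  ∈-pairsWhere⁻ {P} = proj₂ ∘ ∈-filter⁻ (T? ∘ uncurry P) {xs = cartesianProduct (allFin n) (allFin n)}

  pairsWhere-Unique : ∀ P → Unique (pairsWhere P)
  pairsWhere-Unique P = Uniqueₚ.filter⁺ (T? ∘ uncurry P)
    (Uniqueₚ.cartesianProduct⁺ (Uniqueₚ.allFin⁺ n) (Uniqueₚ.allFin⁺ n))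

  count-≤-byRetraction : ∀ (P Q : Fin n → Fin n → Bool) (f g : Fin n × Fin n → Fin n × Fin n) →
    (∀ {p} → T (uncurry P p) → T (uncurry Q (f p))) →
    (∀ {p} → T (uncurry P p) → g (f p) ≡ p) →
    count P ≤ count Q
  count-≤-byRetraction P Q f g f-Q gf≡id = begin
    count P                  ≡⟨ count≡length-pairsWhere P ⟩
    length (pairsWhere P)    ≡⟨ length-map f (pairsWhere P) ⟨
    length (map f (pairsWhere P)) ≤⟨ Unique-⊆⇒length-≤ f[P]-Unique f[P]⊆Q ⟩
    length (pairsWhere Q)    ≡⟨ count≡length-pairsWhere Q ⟨
    count Q                  ∎
    where
    open ≤-Reasoning
    g∘f[P]≡P : map g (map f (pairsWhere P)) ≡ pairsWhere P
    g∘f[P]≡P = trans (sym (map-∘ (pairsWhere P))) (map-id-local (tabulate (gf≡id ∘ ∈-pairsWhere⁻)))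
    f[P]-Unique : Unique (map f (pairsWhere P))
    f[P]-Unique = Uniqueₚ.map⁻ (subst Unique (sym g∘f[P]≡P) (pairsWhere-Unique P))
    f[P]⊆Q : map f (pairsWhere P) ⊆ pairsWhere Q
    f[P]⊆Q q∈ with p , p∈ , refl ← ∈-map⁻ f q∈ = ∈-pairsWhere⁺ (f-Q (∈-pairsWhere⁻ p∈))

  orient : Fin n × Fin n → Fin n × Fin n
  orient (a , b) = if toℕ a <ᵇ toℕ b then (a , b) else (b , a)

  data Orientation (a b : Fin n) : Fin n × Fin n → Set where
    forward  : T (toℕ a <ᵇ toℕ b) → Orientation a b (a , b)
    backward : T (toℕ b <ᵇ toℕ a) → Orientation a b (b , a)

  orientation : ∀ {a b} → a ≢ b → Orientation a b (orient (a , b))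
  orientation {a} {b} a≢b with toℕ a <ᵇ toℕ b in a<ᵇb
  ... | true = forward (Equivalence.from T-≡ a<ᵇb)
  ... | false with <-cmp (toℕ a) (toℕ b)
  ...   | tri< a<b _ _ = ⊥-elim (subst T a<ᵇb (<⇒<ᵇ a<b))
  ...   | tri≈ _ a≡b _ = contradiction (toℕ-injective a≡b) a≢b
  ...   | tri> _ _ b<a = backward (<⇒<ᵇ b<a)

  orient-forward : ∀ {a b} → T (toℕ a <ᵇ toℕ b) → orient (a , b) ≡ (a , b)
  orient-forward {a} {b} a<b with toℕ a <ᵇ toℕ b
  ... | true = refl

  orient-backward : ∀ {a b} → T (toℕ a <ᵇ toℕ b) → orient (b , a) ≡ (a , b)
  orient-backward {a} {b} a<b with toℕ b <ᵇ toℕ a in b<ᵇa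
  ... | true = ⊥-elim (<-asym (<ᵇ⇒< (toℕ a) (toℕ b) a<b) (<ᵇ⇒< (toℕ b) (toℕ a) (Equivalence.from T-≡ b<ᵇa)))
  ... | false = refl

module _ {n : ℕ} (Γ : Graph n) where

  Adj-sym : ∀ {x y} → Adj Γ x y → Adj Γ y x
  Adj-sym {x} {y} = trans (Graph.sym Γ y x)

  NonAdj-sym : ∀ {x y} → NonAdj Γ x y → NonAdj Γ y x
  NonAdj-sym {x} {y} = trans (Graph.sym Γ y x)

  Adj⇒≢ : ∀ {x y} → Adj Γ x y → x ≢ y
  Adj⇒≢ {x} xy refl = contradiction (trans (sym (irrefl Γ x)) xy) λ ()

  Adj⇒¬NonAdj : ∀ {x y} → Adj Γ x y → ¬ NonAdj Γ x y
  Adj⇒¬NonAdj xy x≁y = contradiction (trans (sym xy) x≁y) λ ()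

  universal-∉-InducedP4 : ∀ {z a b c d} → (∀ x → x ≢ z → Adj Γ z x) →
    InducedP4 Γ a b c d → a ≢ z × b ≢ z × c ≢ z × d ≢ z
  universal-∉-InducedP4 {z} {a} {b} {c} {d} universal (ab , bc , cd , a≁c , b≁d , a≁d) =
    a≢z , (λ b≡z → d≢z (only-non-neighbour (subst (λ x → NonAdj Γ x d) b≡z b≁d))) ,
    (λ c≡z → a≢z (only-non-neighbour (subst (λ x → NonAdj Γ x a) c≡z (NonAdj-sym a≁c)))) , d≢z
    where
    only-non-neighbour : ∀ {x} → NonAdj Γ z x → x ≡ z
    only-non-neighbour {x} z≁x with x ≟ z
    ... | yes x≡z = x≡z
    ... | no x≢z = ⊥-elim (Adj⇒¬NonAdj (universal x x≢z) z≁x)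
    a≢z : a ≢ z
    a≢z refl = Adj⇒≢ cd (trans (only-non-neighbour a≁c) (sym (only-non-neighbour a≁d)))
    d≢z : d ≢ z
    d≢z refl = Adj⇒≢ ab (trans (only-non-neighbour (NonAdj-sym a≁d)) (sym (only-non-neighbour (NonAdj-sym b≁d))))

module _ {n : ℕ} {Γ : Graph n} where

  Reach-trans : ∀ {x y z} → Reach Γ x y → Reach Γ y z → Reach Γ x z
  Reach-trans r here = r
  Reach-trans r (step r' a) = step (Reach-trans r r') a

  Reach-sym : ∀ {x y} → Reach Γ x y → Reach Γ y x
  Reach-sym here = here
  Reach-sym (step r a) = Reach-trans (step here (Adj-sym Γ a)) (Reach-sym r)

isYes-true : ∀ {A : Set} (a? : Dec A) → A → ⌊ a? ⌋ ≡ true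
isYes-true a? a = trans (isYes≗does a?) (dec-true a? a)

isYes-false : ∀ {A : Set} (a? : Dec A) → ¬ A → ⌊ a? ⌋ ≡ false
isYes-false a? ¬a = trans (isYes≗does a?) (dec-false a? ¬a)

isFillEdge : ∀ {n} → Graph n → Graph n → Fin n → Fin n → Bool
isFillEdge G H x y = (toℕ x <ᵇ toℕ y) ∧ adj H x y ∧ not (adj G x y)

FillEdge : ∀ {n} → Graph n → Graph n → Fin n → Fin n → Set
FillEdge G H x y = Adj H x y × NonAdj G x y

DecodableFillEdge : ∀ {n} → Graph n → Graph n → (Fin n → Fin n → Fin n) → Fin n → Fin n × Fin n → Set
DecodableFillEdge G H decode w (a , b) = FillEdge G H a b × decode a b ≡ w × decode b a ≡ w

otherEnd : ∀ {n} → Fin n → Fin n × Fin n → Fin n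
otherEnd v (x , y) = if ⌊ x ≟ v ⌋ then y else x

module _ {n : ℕ} (G H : Graph n) where

  isFillEdge⁺ : ∀ {x y} → T (toℕ x <ᵇ toℕ y) → FillEdge G H x y → T (isFillEdge G H x y)
  isFillEdge⁺ x<y (xy , x≁y) =
    Equivalence.from T-∧ (x<y , Equivalence.from T-∧ (Equivalence.from T-≡ xy , Equivalence.from T-not-≡ x≁y))

  isFillEdge⁻ : ∀ {x y} → T (isFillEdge G H x y) → T (toℕ x <ᵇ toℕ y) × FillEdge G H x y
  isFillEdge⁻ fill with x<y , rest ← Equivalence.to T-∧ fill with xy , x≁y ← Equivalence.to T-∧ rest =
    x<y , Equivalence.to T-≡ xy , Equivalence.to T-not-≡ x≁y

  isFillEdge-orient : ∀ {a b} → FillEdge G H a b → T (uncurry (isFillEdge G H) (orient (a , b)))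
  isFillEdge-orient {a} {b} (ab , a≁b) with orient (a , b) | orientation {a = a} {b} (Adj⇒≢ H ab)
  ... | _ | forward a<b = isFillEdge⁺ a<b (ab , a≁b)
  ... | _ | backward b<a = isFillEdge⁺ b<a (Adj-sym H ab , NonAdj-sym G a≁b)

  decode-orient : ∀ (decode : Fin n → Fin n → Fin n) {w} p → DecodableFillEdge G H decode w p →
                  uncurry decode (orient p) ≡ w
  decode-orient _ (a , b) ((ab , _) , ab↦w , ba↦w) with orient (a , b) | orientation {a = a} {b} (Adj⇒≢ H ab)
  ... | _ | forward _ = ab↦w
  ... | _ | backward _ = ba↦w

makeUniversal : ∀ {n} → Graph n → Fin n → Graph n
makeUniversal {n} G v = record
  { adj = λ x y → adj G x y ∨ ((⌊ x ≟ v ⌋ ∨ ⌊ y ≟ v ⌋) ∧ not ⌊ x ≟ y ⌋)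
  ; sym = λ x y → cong₂ _∨_ (Graph.sym G x y) (cong₂ _∧_ (∨-comm ⌊ x ≟ v ⌋ ⌊ y ≟ v ⌋) (cong not (≟-comm x y)))
  ; irrefl = λ x → cong₂ _∨_ (irrefl G x) (trans (cong ((⌊ x ≟ v ⌋ ∨ ⌊ x ≟ v ⌋) ∧_) (cong not (isYes-true (x ≟ x) refl))) (∧-zeroʳ _))
  }
  where
  ≟-comm : ∀ (x y : Fin n) → ⌊ x ≟ y ⌋ ≡ ⌊ y ≟ x ⌋
  ≟-comm x y with x ≟ y
  ... | yes refl = sym (isYes-true (x ≟ x) refl)
  ... | no x≢y = sym (isYes-false (y ≟ x) (x≢y ∘ sym))

module _ {n : ℕ} (G : Graph n) (v : Fin n) where

  makeUniversal-MakeUniversal : MakeUniversal G v (makeUniversal G v)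
  makeUniversal-MakeUniversal _ _ = refl

  makeUniversal-⊇ : ∀ {x y} → Adj G x y → Adj (makeUniversal G v) x y
  makeUniversal-⊇ x~y rewrite x~y = refl

  makeUniversal-universal : ∀ x → x ≢ v → Adj (makeUniversal G v) v x
  makeUniversal-universal x x≢v
    rewrite isYes-true (v ≟ v) refl | isYes-false (v ≟ x) (x≢v ∘ sym) = ∨-zeroʳ (adj G v x)

  makeUniversal-away : ∀ {x y} → x ≢ v → y ≢ v → adj (makeUniversal G v) x y ≡ adj G x y
  makeUniversal-away {x} {y} x≢v y≢v
    rewrite isYes-false (x ≟ v) x≢v | isYes-false (y ≟ v) y≢v = ∨-identityʳ (adj G x y)

  makeUniversal-InducedP4 : ∀ {a b c d} → InducedP4 (makeUniversal G v) a b c d → InducedP4 G a b c d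
  makeUniversal-InducedP4 p4@(ab , bc , cd , a≁c , b≁d , a≁d)
    with a≢v , b≢v , c≢v , d≢v ← universal-∉-InducedP4 (makeUniversal G v) makeUniversal-universal p4 =
    away a≢v b≢v ab , away b≢v c≢v bc , away c≢v d≢v cd ,
    away a≢v c≢v a≁c , away b≢v d≢v b≁d , away a≢v d≢v a≁d
    where
    away : ∀ {x y t} → x ≢ v → y ≢ v → adj (makeUniversal G v) x y ≡ t → adj G x y ≡ t
    away x≢v y≢v = trans (sym (makeUniversal-away x≢v y≢v))

  makeUniversal-P4Sparse : P4Sparse G → P4Sparse (makeUniversal G v)
  makeUniversal-P4Sparse sparse w w-inj p q P₁ P₂ =
    sparse w w-inj p q (makeUniversal-InducedP4 P₁) (makeUniversal-InducedP4 P₂)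

  makeUniversal-IsSolution : ∀ {u} → P4Sparse G → u ≢ v → IsSolution G u v (makeUniversal G v)
  makeUniversal-IsSolution sparse u≢v =
    makeUniversal-P4Sparse sparse , (λ _ _ → makeUniversal-⊇) , Adj-sym (makeUniversal G v) (makeUniversal-universal _ u≢v)

  makeUniversal-newEdge : ∀ {x y} → Adj (makeUniversal G v) x y → NonAdj G x y → x ≡ v ⊎ y ≡ v
  makeUniversal-newEdge {x} {y} xy x≁y with x ≟ v | y ≟ v
  ... | yes x≡v | _ = inj₁ x≡v
  ... | no _ | yes y≡v = inj₂ y≡v
  ... | no _ | no _ = ⊥-elim (Adj⇒¬NonAdj G (trans (sym (∨-identityʳ (adj G x y))) xy) x≁y)

  makeUniversal-fillEdge : ∀ {x y} → T (isFillEdge G (makeUniversal G v) x y) →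
    otherEnd v (x , y) ≢ v × NonAdj G v (otherEnd v (x , y)) × orient (v , otherEnd v (x , y)) ≡ (x , y)
  makeUniversal-fillEdge {x} {y} fill with x<y , xy , x≁y ← isFillEdge⁻ G (makeUniversal G v) {x} {y} fill
                                      with Adj⇒≢ (makeUniversal G v) xy | makeUniversal-newEdge xy x≁y
  ... | x≢y | inj₁ refl rewrite isYes-true (v ≟ v) refl = x≢y ∘ sym , x≁y , orient-forward x<y
  ... | x≢y | inj₂ refl rewrite isYes-false (x ≟ v) x≢y = x≢y , NonAdj-sym G x≁y , orient-backward x<y

  fillCount-makeUniversal-≤ : ∀ H (encode : Fin n → Fin n × Fin n) (decode : Fin n → Fin n → Fin n) →
    (∀ w → w ≢ v → NonAdj G v w → DecodableFillEdge G H decode w (encode w)) →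
    fillCount G (makeUniversal G v) ≤ fillCount G H
  fillCount-makeUniversal-≤ H encode decode encodes =
    count-≤-byRetraction (isFillEdge G (makeUniversal G v)) (isFillEdge G H)
      (orient ∘ encode ∘ otherEnd v) (λ p → orient (v , uncurry decode p)) (λ {p} → toFill {p}) (λ {p} → retraction {p})
    where
    toFill : ∀ {p} → T (uncurry (isFillEdge G (makeUniversal G v)) p) → T (uncurry (isFillEdge G H) (orient (encode (otherEnd v p))))
    toFill {x , y} fill with w≢v , v≁w , _ ← makeUniversal-fillEdge {x} {y} fill =
      isFillEdge-orient G H (proj₁ (encodes (otherEnd v (x , y)) w≢v v≁w))
    retraction : ∀ {p} → T (uncurry (isFillEdge G (makeUniversal G v)) p) → orient (v , uncurry decode (orient (encode (otherEnd v p)))) ≡ p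
    retraction {x , y} fill with w≢v , v≁w , oriented ← makeUniversal-fillEdge {x} {y} fill =
      trans (cong (λ w → orient (v , w)) (decode-orient G H decode (encode w) (encodes w w≢v v≁w))) oriented
      where w = otherEnd v (x , y)

data Component : Set where
  Cᵤ Cᵥ : Component

module Components {n} {G : Graph n} {u v : Fin n} (tc : TwoComponents G u v) where

  root : Component → Fin n
  root Cᵤ = u
  root Cᵥ = v

  componentOf : ∀ {x} → Reach G u x ⊎ Reach G v x → Component
  componentOf (inj₁ _) = Cᵤ
  componentOf (inj₂ _) = Cᵥ

  component : Fin n → Component
  component x = componentOf (proj₂ tc x)

  reach-component : ∀ x → Reach G (root (component x)) x
  reach-component x with proj₂ tc x
  ... | inj₁ u↝x = u↝x
  ... | inj₂ v↝x = v↝x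

  roots-disconnected : ∀ c d {x} → Reach G (root c) x → Reach G (root d) x → c ≡ d
  roots-disconnected Cᵤ Cᵤ _ _ = refl
  roots-disconnected Cᵥ Cᵥ _ _ = refl
  roots-disconnected Cᵤ Cᵥ u↝x v↝x = ⊥-elim (proj₁ tc (Reach-trans u↝x (Reach-sym v↝x)))
  roots-disconnected Cᵥ Cᵤ v↝x u↝x = ⊥-elim (proj₁ tc (Reach-trans u↝x (Reach-sym v↝x)))

  component-≡ : ∀ c {x} → Reach G (root c) x → component x ≡ c
  component-≡ c {x} = roots-disconnected (component x) c (reach-component x)

  u≢v : u ≢ v
  u≢v u≡v = proj₁ tc (subst (Reach G u) u≡v here)

  NonAdj-across : ∀ {x y} → component x ≡ Cᵤ → component y ≡ Cᵥ → NonAdj G x y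
  NonAdj-across {x} {y} x∈Cᵤ y∈Cᵥ with adj G x y in xy
  ... | false = refl
  ... | true = contradiction (trans (sym x∈Cᵤ) (trans (sym (component-≡ _ (step (reach-component x) xy))) y∈Cᵥ)) λ ()

module ThinSpiderEncoding {n} {G : Graph n} {u v : Fin n} (tc : TwoComponents G u v)
  (H : Graph n) (H-solution : IsSolution G u v H)
  {m} {S K : Fin m → Fin n} {R : Fin n → Set}
  (spider : SpiderCore H m S K R) (cover : ∀ x → InSK S K x ⊎ R x) (thin : Thin H S K)
  (u∈R : R u) (v∈R : R v)
  (SK∩Cᵤ : ∃ λ x → InSK S K x × Reach G u x) (SK∩Cᵥ : ∃ λ x → InSK S K x × Reach G v x) where

  open SpiderCore spider
  open Components tc

  G⊆H : ∀ x y → Adj G x y → Adj H x y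
  G⊆H = proj₁ (proj₂ H-solution)

  uv∈H : Adj H u v
  uv∈H = proj₂ (proj₂ H-solution)

  S-neighbour : ∀ {i y} → Adj H (S i) y → y ≡ K i
  S-neighbour {i} {y} Siy with cover y
  ... | inj₁ (inj₁ (j , refl)) = ⊥-elim (Adj⇒¬NonAdj H Siy (S-indep i j))
  ... | inj₁ (inj₂ (j , refl)) = cong K (sym (proj₁ (thin i j) Siy))
  ... | inj₂ y∈R = ⊥-elim (Adj⇒¬NonAdj H Siy (NonAdj-sym H (R-S y i y∈R)))

  Reach-S⇒Reach-K : ∀ {c i} → R c → Reach G c (S i) → Reach G c (K i)
  Reach-S⇒Reach-K c∈R here = ⊥-elim (S∉R _ c∈R)
  Reach-S⇒Reach-K c∈R (step c↝y yS) = subst (Reach G _) (S-neighbour (Adj-sym H (G⊆H _ _ yS))) c↝y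

  root∈R : ∀ c → R (root c)
  root∈R Cᵤ = u∈R
  root∈R Cᵥ = v∈R

  component-S≡component-K : ∀ i → component (S i) ≡ component (K i)
  component-S≡component-K i = sym (component-≡ _ (Reach-S⇒Reach-K (root∈R _) (reach-component (S i))))

  K-meets-component : ∀ c → (∃ λ x → InSK S K x × Reach G (root c) x) → ∃ λ i → component (K i) ≡ c
  K-meets-component c (_ , inj₁ (i , refl) , c↝Si) = i , component-≡ c (Reach-S⇒Reach-K (root∈R c) c↝Si)
  K-meets-component c (_ , inj₂ (i , refl) , c↝Ki) = i , component-≡ c c↝Ki

  iᵤ iᵥ : Fin m
  iᵤ = proj₁ (K-meets-component Cᵤ SK∩Cᵤ)
  iᵥ = proj₁ (K-meets-component Cᵥ SK∩Cᵥ)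

  kᵤ kᵥ : Fin n
  kᵤ = K iᵤ
  kᵥ = K iᵥ

  data Role : Set where
    inS inK : Fin m → Role
    inR : Role

  HasRole : Fin n → Role → Set
  HasRole x (inS i) = S i ≡ x
  HasRole x (inK i) = K i ≡ x
  HasRole x inR = R x

  roleOf : ∀ {x} → InSK S K x ⊎ R x → Role
  roleOf (inj₁ (inj₁ (i , _))) = inS i
  roleOf (inj₁ (inj₂ (i , _))) = inK i
  roleOf (inj₂ _) = inR

  role : Fin n → Role
  role x = roleOf (cover x)

  hasRole : ∀ x → HasRole x (role x)
  hasRole x with cover x
  ... | inj₁ (inj₁ (_ , Si≡x)) = Si≡x
  ... | inj₁ (inj₂ (_ , Ki≡x)) = Ki≡x
  ... | inj₂ x∈R = x∈R

  role-K : ∀ i → role (K i) ≡ inK i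
  role-K i with cover (K i)
  ... | inj₁ (inj₁ (j , Sj≡Ki)) = ⊥-elim (S≢K j i Sj≡Ki)
  ... | inj₁ (inj₂ (j , Kj≡Ki)) = cong inK (K-inj j i Kj≡Ki)
  ... | inj₂ Ki∈R = ⊥-elim (K∉R i Ki∈R)

  role-R : ∀ {x} → R x → role x ≡ inR
  role-R {x} x∈R with cover x
  ... | inj₁ (inj₁ (j , refl)) = ⊥-elim (S∉R j x∈R)
  ... | inj₁ (inj₂ (j , refl)) = ⊥-elim (K∉R j x∈R)
  ... | inj₂ _ = refl

  encodeAt : Role → Component → Fin n → Fin n × Fin n
  encodeAt inR     Cᵤ w = if ⌊ w ≟ u ⌋ then (u , v) else (w , kᵥ)
  encodeAt (inK i) Cᵤ _ = (K i , v)
  encodeAt (inS i) Cᵤ _ = (K i , kᵥ)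
  encodeAt inR     Cᵥ w = (w , kᵤ)
  encodeAt (inK j) Cᵥ _ = (v , K j)
  encodeAt (inS j) Cᵥ _ = (u , K j)

  encode : Fin n → Fin n × Fin n
  encode w = encodeAt (role w) (component w) w

  -- The catch-all clause decodes u v and K j v (with K j ∈ C_v).
  decodeAt : Role → Component → Role → Component → Fin n → Fin n → Fin n
  decodeAt inR     Cᵥ inR     Cᵤ a b = b
  decodeAt inR     Cᵤ (inK j) Cᵥ a b = if ⌊ a ≟ u ⌋ then S j else a
  decodeAt (inK j) Cᵥ inR     Cᵤ a b = if ⌊ b ≟ u ⌋ then S j else b
  decodeAt (inK _) Cᵤ inR     Cᵥ a b = if ⌊ b ≟ v ⌋ then a else b
  decodeAt inR     Cᵥ (inK _) Cᵤ a b = if ⌊ a ≟ v ⌋ then b else a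
  decodeAt (inK i) Cᵤ (inK _) Cᵥ a b = S i
  decodeAt (inK _) Cᵥ (inK i) Cᵤ a b = S i
  decodeAt inR     Cᵥ (inK _) Cᵥ a b = b
  decodeAt _       _  _       _  a b = a

  decode : Fin n → Fin n → Fin n
  decode a b = decodeAt (role a) (component a) (role b) (component b) a b

  u∈Cᵤ : component u ≡ Cᵤ
  u∈Cᵤ = component-≡ Cᵤ here

  v∈Cᵥ : component v ≡ Cᵥ
  v∈Cᵥ = component-≡ Cᵥ here

  kᵤ∈Cᵤ : component kᵤ ≡ Cᵤ
  kᵤ∈Cᵤ = proj₂ (K-meets-component Cᵤ SK∩Cᵤ)

  kᵥ∈Cᵥ : component kᵥ ≡ Cᵥ
  kᵥ∈Cᵥ = proj₂ (K-meets-component Cᵥ SK∩Cᵥ)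

  encodesAt : ∀ {w} r c → HasRole w r → component w ≡ c → w ≢ v → NonAdj G v w →
              DecodableFillEdge G H decode w (encodeAt r c w)
  encodesAt {w} inR Cᵤ w∈R w∈Cᵤ _ _ with w ≟ u
  ... | yes refl rewrite role-R u∈R | w∈Cᵤ | role-R v∈R | v∈Cᵥ =
    (uv∈H , NonAdj-across u∈Cᵤ v∈Cᵥ) , refl , refl
  ... | no w≢u rewrite role-R w∈R | w∈Cᵤ | role-K iᵥ | kᵥ∈Cᵥ | isYes-false (w ≟ u) w≢u =
    (R-K w iᵥ w∈R , NonAdj-across w∈Cᵤ kᵥ∈Cᵥ) , refl , refl
  encodesAt (inK i) Cᵤ refl Ki∈Cᵤ _ _ rewrite role-K i | Ki∈Cᵤ | role-R v∈R | v∈Cᵥ | isYes-true (v ≟ v) refl =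
    (Adj-sym H (R-K v i v∈R) , NonAdj-across Ki∈Cᵤ v∈Cᵥ) , refl , refl
  encodesAt (inS i) Cᵤ refl Si∈Cᵤ _ _ rewrite role-K i | sym (component-S≡component-K i) | Si∈Cᵤ | role-K iᵥ | kᵥ∈Cᵥ =
    (K-clique i iᵥ i≢iᵥ , NonAdj-across Ki∈Cᵤ kᵥ∈Cᵥ) , refl , refl
    where
    Ki∈Cᵤ : component (K i) ≡ Cᵤ
    Ki∈Cᵤ = trans (sym (component-S≡component-K i)) Si∈Cᵤ
    i≢iᵥ : i ≢ iᵥ
    i≢iᵥ refl = contradiction (trans (sym Ki∈Cᵤ) kᵥ∈Cᵥ) λ ()
  encodesAt {w} inR Cᵥ w∈R w∈Cᵥ w≢v _ rewrite role-R w∈R | w∈Cᵥ | role-K iᵤ | kᵤ∈Cᵤ | isYes-false (w ≟ v) w≢v =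
    (R-K w iᵤ w∈R , NonAdj-sym G (NonAdj-across kᵤ∈Cᵤ w∈Cᵥ)) , refl , refl
  encodesAt (inK j) Cᵥ refl Kj∈Cᵥ _ v≁Kj rewrite role-R v∈R | v∈Cᵥ | role-K j | Kj∈Cᵥ =
    (R-K v j v∈R , v≁Kj) , refl , refl
  encodesAt (inS j) Cᵥ refl Sj∈Cᵥ _ _ rewrite role-R u∈R | u∈Cᵤ | role-K j | sym (component-S≡component-K j) | Sj∈Cᵥ | isYes-true (u ≟ u) refl =
    (R-K u j u∈R , NonAdj-across u∈Cᵤ Kj∈Cᵥ) , refl , refl
    where
    Kj∈Cᵥ : component (K j) ≡ Cᵥ
    Kj∈Cᵥ = trans (sym (component-S≡component-K j)) Sj∈Cᵥ

  encodes : ∀ w → w ≢ v → NonAdj G v w → DecodableFillEdge G H decode w (encode w)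
  encodes w = encodesAt (role w) (component w) (hasRole w) refl

lemma5 : ∀ {n} (G : Graph n) (u v : Fin n) →
    P4Sparse G → TwoComponents G u v →
    (H : Graph n) → IsOptimal G u v H →
    (m : ℕ) (S K : Fin m → Fin n) (R : Fin n → Set) →
    SpiderPartition H m S K R → Thin H S K → R u → R v →
    (∃ λ x → InSK S K x × Reach G u x) → (∃ λ x → InSK S K x × Reach G v x) →
    Σ (Graph n) λ H' → IsOptimal G u v H' ×
    ((MakeUniversal G u H' ⊎ MakeUniversal G v H') ⊎
    (CaseB G K u v × (SubtreeIdentical H' G u u ⊎ SubtreeIdentical H' G u v)))
lemma5 G u v sparse tc H (H-solution , H-minimal) m S K R (spider , cover , _) thin u∈R v∈R SK∩Cᵤ SK∩Cᵥ =
  makeUniversal G v ,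
  (makeUniversal-IsSolution G v sparse u≢v , λ H₂ H₂-solution → ≤-trans universal≤H (H-minimal H₂ H₂-solution)) ,
  inj₁ (inj₂ (makeUniversal-MakeUniversal G v))
  where
  open Components tc using (u≢v)
  open ThinSpiderEncoding tc H H-solution spider cover thin u∈R v∈R SK∩Cᵤ SK∩Cᵥ using (encode; decode; encodes)
  universal≤H : fillCount G (makeUniversal G v) ≤ fillCount G H
  universal≤H = fillCount-makeUniversal-≤ G v H encode decode encodes
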